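{- Let $\varphi$ be an $\mathcal L^X_{\mathsf{PA}}$-sentence that is disjunctive or of the form $\neg Xt$, with $\mathrm{rk}(\varphi)\leq d$. If $\vdash^\alpha_d\Gamma,\neg\varphi$ and $\vdash^\beta_d\Gamma,\varphi$, then $\vdash^{\alpha+\beta}_d\Gamma$.
   Context: $\mathcal L_{\mathsf{PA}}$ is the first-order language with $0,S,+,\times,\leq,=$; $\mathcal L^X_{\mathsf{PA}}$ adds a unary relation symbol $X$. Formulas are in negation normal form (built from literals by $\land,\lor,\forall,\exists$), $\neg\varphi$ defined by de Morgan's laws. "True" refers to the standard model $\mathbb N$. Rank: literals $0$, $\mathrm{rk}(\varphi_0\land\varphi_1)=\mathrm{rk}(\varphi_0\lor\varphi_1)=\max+1$, $\mathrm{rk}(\forall x\varphi)=\mathrm{rk}(\exists x\varphi)=\mathrm{rk}(\varphi)+1$. Conjunctive sentences: true $\mathcal L_{\mathsf{PA}}$-literals (empty index set), $\varphi_0\land\varphi_1$ (components $\varphi_0,\varphi_1$), $\forall x\varphi$ (components $\varphi[x/t]$, $t$ closed terms). Disjunctive sentences are the negations of conjunctive ones (i.e. false $\mathcal L_{\mathsf{PA}}$-literals, $\varphi_0\lor\varphi_1$, $\exists x\varphi$), with components the negations of the components. $(E,\prec)$ is a well order with: a unary map $\alpha\mapsto\alpha+1$ with $\alpha\prec\alpha+1$; elements $0,\omega\in E$ with $0\prec\omega$ such that $\alpha\prec\omega$ implies $\alpha+1\prec\omega$; a binary operation $+:E^2\to E$ (the expression "$\alpha+1$" always means the unary map) with $\alpha+0=\alpha$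 and $\beta\prec\gamma\Rightarrow\alpha+\beta\prec\alpha+\gamma$; a map $\omega:E\to E$ with $\alpha\prec\beta\Rightarrow\omega(\alpha)\prec\omega(\beta)$ and $\alpha,\beta\prec\omega(\gamma)\Rightarrow\alpha+\beta\prec\omega(\gamma)$; moreover $\alpha\prec\beta$ implies $\alpha+1\preceq\beta$, and $0\preceq\alpha$ for all $\alpha$. $x\lhd y$ is a fixed $\mathcal L_{\mathsf{PA}}$-formula with free variables $x,y$ only, defining a well order on $\mathbb N$. A sequent is a finite set of $\mathcal L^X_{\mathsf{PA}}$-sentences; $\Gamma,\varphi$ denotes $\Gamma\cup\{\varphi\}$. By recursion on $\alpha\in E$, $\vdash^\alpha_d\Gamma$ holds exactly if one of: (i) $\Gamma$ contains a true $\mathcal L_{\mathsf{PA}}$-literal, or $Xs$ and $\neg Xt$ with closed terms $s,t$ of equal value; (ii) $\Gamma$ contains $\varphi_0\land\varphi_1$ (resp. $\varphi_0\lor\varphi_1$) and for every (resp. some) $i\in\{0,1\}$: $\vdash^{\alpha(i)}_{d(i)}\Delta_i$ with $\alpha(i)\prec\alpha$, $d(i)\leq d$, $\Delta_i\subseteq\Gamma,\varphi_i$; (iii) $\Gamma$ contains $\forall x\varphi$ (resp. $\exists x\varphi$) and for every (resp. some) closed term $t$: $\vdash^{\alpha(t)}_{d(t)}\Delta_t$ with $\alpha(t)\prec\alpha$, $d(t)\leq d$, $\Delta_t\subseteq\Gamma,\varphi[x/t]$; (iv) $\Gamma$ contains $Xt$ and for every closed term $s$ with $s\lhd t$ (by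 value): $\vdash^{\alpha(s)}_{d(s)}\Delta_s$ with $\alpha(s)\prec\alpha$, $d(s)\leq d$, $\Delta_s\subseteq\Gamma,Xs$; (v) for some sentence $\varphi$ with $\mathrm{rk}(\varphi)<d$: $\vdash^{\alpha(0)}_{d(0)}\Delta_0$ and $\vdash^{\alpha(1)}_{d(1)}\Delta_1$ with $\alpha(i)\prec\alpha$, $d(i)\leq d$, $\Delta_0\subseteq\Gamma,\varphi$, $\Delta_1\subseteq\Gamma,\neg\varphi$. -}

module Defs where

open import Data.Nat using (ℕ; zero; suc; _≤_; _<_; _⊔_)
import Data.Nat as N
open import Data.Fin using (Fin; zero; suc)
open import Data.List using (List; _∷_)
open import Data.List.Relation.Binary.Subset.Propositional using (_⊆_)
open import Data.List.Membership.Propositional using (_∈_)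
open import Data.Product using (Σ; ∃; _×_; _,_)
open import Data.Sum using (_⊎_)
open import Data.Empty using (⊥)
open import Relation.Nullary using (¬_)
open import Relation.Binary.PropositionalEquality using (_≡_)
open import Relation.Binary.Structures using (IsStrictTotalOrder)
open import Induction.WellFounded using (WellFounded)

-- Syntax of L_PA^X (de Bruijn variables; Term n / Fm n have n free vars)

data Term (n : ℕ) : Set where
  var  : Fin n → Term n
  `0   : Term n
  `S   : Term n → Term n
  _`+_ : Term n → Term n → Term n
  _`*_ : Term n → Term n → Term n

-- formulas in negation normal form
data Fm (n : ℕ) : Set where
  _`=_  : Term n → Term n → Fm n
  _`≠_  : Term n → Term n → Fm n
  _`≤_  : Term n → Term n → Fm n
  _`≰_  : Term n → Term n → Fm n
  `X    : Term n → Fm n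
  `¬X   : Term n → Fm n
  _`∧_  : Fm n → Fm n → Fm n
  _`∨_  : Fm n → Fm n → Fm n
  `∀    : Fm (suc n) → Fm n
  `∃    : Fm (suc n) → Fm n

Sentence : Set
Sentence = Fm 0

ClosedTerm : Set
ClosedTerm = Term 0

neg : ∀ {n} → Fm n → Fm n
neg (s `= t) = s `≠ t
neg (s `≠ t) = s `= t
neg (s `≤ t) = s `≰ t
neg (s `≰ t) = s `≤ t
neg (`X t)   = `¬X t
neg (`¬X t)  = `X t
neg (φ `∧ ψ) = neg φ `∨ neg ψ
neg (φ `∨ ψ) = neg φ `∧ neg ψ
neg (`∀ φ)   = `∃ (neg φ)
neg (`∃ φ)   = `∀ (neg φ)

rk : ∀ {n} → Fm n → ℕ
rk (φ `∧ ψ) = suc (rk φ ⊔ rk ψ)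
rk (φ `∨ ψ) = suc (rk φ ⊔ rk ψ)
rk (`∀ φ)   = suc (rk φ)
rk (`∃ φ)   = suc (rk φ)
rk _        = 0

data IsPA {n : ℕ} : Fm n → Set where
  eq  : ∀ s t → IsPA (s `= t)
  neq : ∀ s t → IsPA (s `≠ t)
  le  : ∀ s t → IsPA (s `≤ t)
  nle : ∀ s t → IsPA (s `≰ t)
  and : ∀ {φ ψ} → IsPA φ → IsPA ψ → IsPA (φ `∧ ψ)
  or  : ∀ {φ ψ} → IsPA φ → IsPA ψ → IsPA (φ `∨ ψ)
  all : ∀ {φ} → IsPA φ → IsPA (`∀ φ)
  ex  : ∀ {φ} → IsPA φ → IsPA (`∃ φ)

renT : ∀ {n m} → (Fin n → Fin m) → Term n → Term m
renT r (var i)  = var (r i)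
renT r `0       = `0
renT r (`S t)   = `S (renT r t)
renT r (s `+ t) = renT r s `+ renT r t
renT r (s `* t) = renT r s `* renT r t

substT : ∀ {n m} → (Fin n → Term m) → Term n → Term m
substT σ (var i)  = σ i
substT σ `0       = `0
substT σ (`S t)   = `S (substT σ t)
substT σ (s `+ t) = substT σ s `+ substT σ t
substT σ (s `* t) = substT σ s `* substT σ t

lift : ∀ {n m} → (Fin n → Term m) → Fin (suc n) → Term (suc m)
lift σ zero    = var zero
lift σ (suc i) = renT suc (σ i)

subst : ∀ {n m} → (Fin n → Term m) → Fm n → Fm m
subst σ (s `= t) = substT σ s `= substT σ t
subst σ (s `≠ t) = substT σ s `≠ substT σ t
subst σ (s `≤ t) = substT σ s `≤ substT σ t
subst σ (s `≰ t) = substT σ s `≰ substT σ t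
subst σ (`X t)   = `X (substT σ t)
subst σ (`¬X t)  = `¬X (substT σ t)
subst σ (φ `∧ ψ) = subst σ φ `∧ subst σ ψ
subst σ (φ `∨ ψ) = subst σ φ `∨ subst σ ψ
subst σ (`∀ φ)   = `∀ (subst (lift σ) φ)
subst σ (`∃ φ)   = `∃ (subst (lift σ) φ)

-- φ[x/t] for the bound variable x of ∀xφ / ∃xφ and a closed term t
_[_] : Fm 1 → ClosedTerm → Sentence
φ [ t ] = subst (λ _ → t) φ

⟦_⟧ : ∀ {n} → Term n → (Fin n → ℕ) → ℕ
⟦ var i ⟧ ρ  = ρ i
⟦ `0 ⟧ ρ     = 0
⟦ `S t ⟧ ρ   = suc (⟦ t ⟧ ρ)
⟦ s `+ t ⟧ ρ = ⟦ s ⟧ ρ N.+ ⟦ t ⟧ ρ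
⟦ s `* t ⟧ ρ = ⟦ s ⟧ ρ N.* ⟦ t ⟧ ρ

val : ClosedTerm → ℕ
val t = ⟦ t ⟧ (λ ())

_∷ρ_ : ∀ {n} → ℕ → (Fin n → ℕ) → Fin (suc n) → ℕ
(a ∷ρ ρ) zero    = a
(a ∷ρ ρ) (suc i) = ρ i

-- Tarski truth for L_PA-formulas (X-literals are not L_PA; they get ⊥,
-- and Sat is only applied to formulas satisfying IsPA)
Sat : ∀ {n} → Fm n → (Fin n → ℕ) → Set
Sat (s `= t) ρ = ⟦ s ⟧ ρ ≡ ⟦ t ⟧ ρ
Sat (s `≠ t) ρ = ¬ (⟦ s ⟧ ρ ≡ ⟦ t ⟧ ρ)
Sat (s `≤ t) ρ = ⟦ s ⟧ ρ ≤ ⟦ t ⟧ ρ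
Sat (s `≰ t) ρ = ¬ (⟦ s ⟧ ρ ≤ ⟦ t ⟧ ρ)
Sat (`X t)   ρ = ⊥
Sat (`¬X t)  ρ = ⊥
Sat (φ `∧ ψ) ρ = Sat φ ρ × Sat ψ ρ
Sat (φ `∨ ψ) ρ = Sat φ ρ ⊎ Sat ψ ρ
Sat (`∀ φ)   ρ = (a : ℕ) → Sat φ (a ∷ρ ρ)
Sat (`∃ φ)   ρ = Σ ℕ λ a → Sat φ (a ∷ρ ρ)

data TrueLit : Sentence → Set where
  eq  : ∀ s t → val s ≡ val t → TrueLit (s `= t)
  neq : ∀ s t → ¬ (val s ≡ val t) → TrueLit (s `≠ t)
  le  : ∀ s t → val s ≤ val t → TrueLit (s `≤ t)
  nle : ∀ s t → ¬ (val s ≤ val t) → TrueLit (s `≰ t)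

data Disjunctive : Sentence → Set where
  eq  : ∀ s t → ¬ (val s ≡ val t) → Disjunctive (s `= t)
  neq : ∀ s t → val s ≡ val t → Disjunctive (s `≠ t)
  le  : ∀ s t → ¬ (val s ≤ val t) → Disjunctive (s `≤ t)
  nle : ∀ s t → val s ≤ val t → Disjunctive (s `≰ t)
  or  : ∀ φ ψ → Disjunctive (φ `∨ ψ)
  ex  : ∀ φ → Disjunctive (`∃ φ)

-- The relation x ◁ y given by an L_PA-formula with free variables x, y
-- (x = variable zero, y = variable suc zero)

Rel◁ : Fm 2 → ℕ → ℕ → Set
Rel◁ lhd m n = Sat lhd (m ∷ρ (n ∷ρ (λ ())))

DefinesWellOrder : Fm 2 → Set
DefinesWellOrder lhd =
  IsPA lhd × IsStrictTotalOrder _≡_ (Rel◁ lhd) × WellFounded (Rel◁ lhd)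

record OrdinalStructure : Set₁ where
  field
    Carrier : Set
    _≺_     : Carrier → Carrier → Set
    isSTO   : IsStrictTotalOrder _≡_ _≺_
    wf      : WellFounded _≺_
    _+1     : Carrier → Carrier
    𝟘       : Carrier
    ω       : Carrier
    _⊕_     : Carrier → Carrier → Carrier
    ωf      : Carrier → Carrier

  _⪯_ : Carrier → Carrier → Set
  α ⪯ β = α ≺ β ⊎ α ≡ β

  field
    <+1       : ∀ α → α ≺ (α +1)
    𝟘≺ω       : 𝟘 ≺ ω
    ω-lim     : ∀ α → α ≺ ω → (α +1) ≺ ω
    ⊕-𝟘       : ∀ α → (α ⊕ 𝟘) ≡ α
    ⊕-mono    : ∀ α β γ → β ≺ γ → (α ⊕ β) ≺ (α ⊕ γ)
    ωf-mono   : ∀ α β → α ≺ β → ωf α ≺ ωf β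
    ωf-closed : ∀ α β γ → α ≺ ωf γ → β ≺ ωf γ → (α ⊕ β) ≺ ωf γ
    ≺⇒+1⪯     : ∀ α β → α ≺ β → (α +1) ⪯ β
    𝟘⪯        : ∀ α → 𝟘 ⪯ α

-- The infinitary proof calculus ⊢^α_d Γ  (sequents as lists, read as sets:
-- only membership and ⊆ are ever used)

Sequent : Set
Sequent = List Sentence

module Calculus (E : OrdinalStructure) (lhd : Fm 2) where
  open OrdinalStructure E

  data ⊢[_,_]_ : Carrier → ℕ → Sequent → Set
  record Premise (α : Carrier) (d : ℕ) (Γ : Sequent) (φ : Sentence) : Set

  data ⊢[_,_]_ where
    ax-lit : ∀ {α d Γ} φ → φ ∈ Γ → TrueLit φ → ⊢[ α , d ] Γ
    ax-X   : ∀ {α d Γ} s t → `X s ∈ Γ → `¬X t ∈ Γ → val s ≡ val t → ⊢[ α , d ] Γ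
    r-∧    : ∀ {α d Γ} φ₀ φ₁ → (φ₀ `∧ φ₁) ∈ Γ →
             Premise α d Γ φ₀ → Premise α d Γ φ₁ → ⊢[ α , d ] Γ
    r-∨₀   : ∀ {α d Γ} φ₀ φ₁ → (φ₀ `∨ φ₁) ∈ Γ → Premise α d Γ φ₀ → ⊢[ α , d ] Γ
    r-∨₁   : ∀ {α d Γ} φ₀ φ₁ → (φ₀ `∨ φ₁) ∈ Γ → Premise α d Γ φ₁ → ⊢[ α , d ] Γ
    r-∀    : ∀ {α d Γ} φ → `∀ φ ∈ Γ →
             ((t : ClosedTerm) → Premise α d Γ (φ [ t ])) → ⊢[ α , d ] Γ
    r-∃    : ∀ {α d Γ} φ → `∃ φ ∈ Γ → (t : ClosedTerm) →
             Premise α d Γ (φ [ t ]) → ⊢[ α , d ] Γ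
    r-X    : ∀ {α d Γ} t → `X t ∈ Γ →
             ((s : ClosedTerm) → Rel◁ lhd (val s) (val t) → Premise α d Γ (`X s)) →
             ⊢[ α , d ] Γ
    r-cut  : ∀ {α d Γ} φ → rk φ < d →
             Premise α d Γ φ → Premise α d Γ (neg φ) → ⊢[ α , d ] Γ

  record Premise α d Γ φ where
    inductive
    constructor prem
    field
      α′   : Carrier
      α′≺α : α′ ≺ α
      d′   : ℕ
      d′≤d : d′ ≤ d
      Δ    : Sequent
      Δ⊆   : Δ ⊆ (φ ∷ Γ)
      pf   : ⊢[ α′ , d′ ] Δ

{-# OPTIONS --safe #-}
module Submission where

-- Induction on the derivation of Γ, φ, keeping the derivation of Γ, ¬φ fixed:
-- every inference is copied unless φ is its principal formula.  A false
-- literal is never principal.  If φ is a disjunction or ∃xψ, its principal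
-- inference derives Γ, φ from Γ, φ, χ for a component χ; the induction
-- hypothesis gives Γ, χ at height α + β′, inverting the conjunctive ¬φ gives
-- Γ, ¬χ at height α, and a cut on χ (rank < rk φ ≤ d) yields Γ at height
-- α + β.  If φ = ¬Xt, it is principal only in an axiom with Xs ∈ Γ and
-- s = t, and then replacing Xt by Xs in the derivation of Γ, Xt gives Γ.

open import Defs
open import Data.Nat using (ℕ; suc; _≤_; _<_; _⊔_; s≤s)
open import Data.Nat.Properties using (≤-refl; ≤-reflexive; ≤-trans; <-≤-trans; m≤m⊔n; m≤n⊔m)
open import Data.Fin using (Fin)
open import Data.List using (_∷_)
open import Data.List.Relation.Unary.Any using (here; there)
open import Data.List.Relation.Binary.Subset.Propositional using (_⊆_)
open import Data.List.Relation.Binary.Subset.Propositional.Properties using (⊆-refl; ⊆-trans; ∷⁺ʳ; xs⊆x∷xs; ∈-∷⁺ʳ)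
open import Data.List.Membership.Propositional using (_∈_)
open import Data.Product using (Σ; _,_)
open import Data.Sum using (_⊎_; inj₁; inj₂)
open import Data.Empty using (⊥-elim)
open import Relation.Nullary using (¬_)
open import Relation.Binary.PropositionalEquality using (_≡_; refl; sym; trans; cong; cong₂)
  renaming (subst to ≡-subst)
open import Relation.Binary.Structures using (IsStrictTotalOrder)

neg-subst : ∀ {n m} (σ : Fin n → Term m) (φ : Fm n) → neg (subst σ φ) ≡ subst σ (neg φ)
neg-subst σ (s `= t) = refl
neg-subst σ (s `≠ t) = refl
neg-subst σ (s `≤ t) = refl
neg-subst σ (s `≰ t) = refl
neg-subst σ (`X t)   = refl
neg-subst σ (`¬X t)  = refl
neg-subst σ (φ `∧ ψ) = cong₂ _`∨_ (neg-subst σ φ) (neg-subst σ ψ)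
neg-subst σ (φ `∨ ψ) = cong₂ _`∧_ (neg-subst σ φ) (neg-subst σ ψ)
neg-subst σ (`∀ φ)   = cong `∃ (neg-subst (lift σ) φ)
neg-subst σ (`∃ φ)   = cong `∀ (neg-subst (lift σ) φ)

rk-subst : ∀ {n m} (σ : Fin n → Term m) (φ : Fm n) → rk (subst σ φ) ≡ rk φ
rk-subst σ (s `= t) = refl
rk-subst σ (s `≠ t) = refl
rk-subst σ (s `≤ t) = refl
rk-subst σ (s `≰ t) = refl
rk-subst σ (`X t)   = refl
rk-subst σ (`¬X t)  = refl
rk-subst σ (φ `∧ ψ) = cong₂ (λ a b → suc (a ⊔ b)) (rk-subst σ φ) (rk-subst σ ψ)
rk-subst σ (φ `∨ ψ) = cong₂ (λ a b → suc (a ⊔ b)) (rk-subst σ φ) (rk-subst σ ψ)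
rk-subst σ (`∀ φ)   = cong suc (rk-subst (lift σ) φ)
rk-subst σ (`∃ φ)   = cong suc (rk-subst (lift σ) φ)

rk-[]<rk-∃ : ∀ φ t → rk (φ [ t ]) < rk (`∃ φ)
rk-[]<rk-∃ φ t = s≤s (≤-reflexive (rk-subst (λ _ → t) φ))

Disjunctive⇒¬TrueLit : ∀ {φ} → Disjunctive φ → ¬ TrueLit φ
Disjunctive⇒¬TrueLit (eq s t s≢t)  (eq .s .t s≡t)  = s≢t s≡t
Disjunctive⇒¬TrueLit (neq s t s≡t) (neq .s .t s≢t) = s≢t s≡t
Disjunctive⇒¬TrueLit (le s t s≰t)  (le .s .t s≤t)  = s≰t s≤t
Disjunctive⇒¬TrueLit (nle s t s≤t) (nle .s .t s≰t) = s≰t s≤t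

Reducible : Sentence → Set
Reducible φ = Disjunctive φ ⊎ Σ ClosedTerm (λ t → φ ≡ `¬X t)

Reducible⇒¬TrueLit : ∀ {φ} → Reducible φ → ¬ TrueLit φ
Reducible⇒¬TrueLit (inj₁ φ-disj) = Disjunctive⇒¬TrueLit φ-disj
Reducible⇒¬TrueLit (inj₂ (_ , refl)) ()

¬Reducible-X : ∀ {t} → ¬ Reducible (`X t)
¬Reducible-X (inj₁ ())
¬Reducible-X (inj₂ (_ , ()))

¬Reducible-∧ : ∀ {φ ψ} → ¬ Reducible (φ `∧ ψ)
¬Reducible-∧ (inj₁ ())
¬Reducible-∧ (inj₂ (_ , ()))

¬Reducible-∀ : ∀ {φ} → ¬ Reducible (`∀ φ)
¬Reducible-∀ (inj₁ ())
¬Reducible-∀ (inj₂ (_ , ()))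

data Component : Sentence → Sentence → Set where
  ∧-left  : ∀ {φ ψ} → Component (φ `∧ ψ) φ
  ∧-right : ∀ {φ ψ} → Component (φ `∧ ψ) ψ
  ∀-inst  : ∀ {φ} t → Component (`∀ φ) (φ [ t ])

Component⇒¬TrueLit : ∀ {ψ χ} → Component ψ χ → ¬ TrueLit ψ
Component⇒¬TrueLit ∧-left     ()
Component⇒¬TrueLit ∧-right    ()
Component⇒¬TrueLit (∀-inst _) ()

∷-under : ∀ {φ θ : Sentence} {Δ Γ} → Δ ⊆ φ ∷ Γ → θ ∷ Δ ⊆ φ ∷ θ ∷ Γ
∷-under {φ} {θ} {Γ = Γ} Δ⊆ = ∈-∷⁺ʳ (there (here refl)) (⊆-trans Δ⊆ (∷⁺ʳ φ (xs⊆x∷xs Γ θ)))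

∷-contract : ∀ {θ : Sentence} {Γ} → θ ∷ θ ∷ Γ ⊆ θ ∷ Γ
∷-contract = ∈-∷⁺ʳ (here refl) ⊆-refl

module Ordinals (E : OrdinalStructure) where
  open OrdinalStructure E

  ≺-trans : ∀ {α β γ} → α ≺ β → β ≺ γ → α ≺ γ
  ≺-trans = IsStrictTotalOrder.trans isSTO

  ≺-⪯-trans : ∀ {α β γ} → α ≺ β → β ⪯ γ → α ≺ γ
  ≺-⪯-trans α≺β (inj₁ β≺γ) = ≺-trans α≺β β≺γ
  ≺-⪯-trans α≺β (inj₂ refl) = α≺β

  ⪯-≺-trans : ∀ {α β γ} → α ⪯ β → β ≺ γ → α ≺ γ
  ⪯-≺-trans (inj₁ α≺β) β≺γ = ≺-trans α≺β β≺γ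
  ⪯-≺-trans (inj₂ refl) β≺γ = β≺γ

  α⪯α⊕β : ∀ α β → α ⪯ (α ⊕ β)
  α⪯α⊕β α β with 𝟘⪯ β
  ... | inj₁ 𝟘≺β  = inj₁ (≡-subst (_≺ (α ⊕ β)) (⊕-𝟘 α) (⊕-mono α 𝟘 β 𝟘≺β))
  ... | inj₂ refl = inj₂ (sym (⊕-𝟘 α))

  α≺α⊕β : ∀ α {β′ β} → β′ ≺ β → α ≺ (α ⊕ β)
  α≺α⊕β α {β′} {β} β′≺β = ⪯-≺-trans (α⪯α⊕β α β′) (⊕-mono α β′ β β′≺β)

module _ (E : OrdinalStructure) (lhd : Fm 2) where
  open OrdinalStructure E
  open Calculus E lhd
  open Ordinals E

  weakenPremise : ∀ {α α′ d d′ Δ Γ φ} → α ⪯ α′ → d ≤ d′ → Δ ⊆ Γ →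
                  Premise α d Δ φ → Premise α′ d′ Γ φ
  weakenPremise α⪯ d≤ Δ⊆Γ (prem β β≺α e e≤d Λ Λ⊆ pf) =
    prem β (≺-⪯-trans β≺α α⪯) e (≤-trans e≤d d≤) Λ (⊆-trans Λ⊆ (∷⁺ʳ _ Δ⊆Γ)) pf

  weaken : ∀ {α α′ d d′ Δ Γ} → α ⪯ α′ → d ≤ d′ → Δ ⊆ Γ → ⊢[ α , d ] Δ → ⊢[ α′ , d′ ] Γ
  weaken _  _  Δ⊆Γ (ax-lit φ φ∈ true)       = ax-lit φ (Δ⊆Γ φ∈) true
  weaken _  _  Δ⊆Γ (ax-X s t Xs∈ ¬Xt∈ s≡t) = ax-X s t (Δ⊆Γ Xs∈) (Δ⊆Γ ¬Xt∈) s≡t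
  weaken α⪯ d≤ Δ⊆Γ (r-∧ φ₀ φ₁ ∈Δ p q) =
    r-∧ φ₀ φ₁ (Δ⊆Γ ∈Δ) (weakenPremise α⪯ d≤ Δ⊆Γ p) (weakenPremise α⪯ d≤ Δ⊆Γ q)
  weaken α⪯ d≤ Δ⊆Γ (r-∨₀ φ₀ φ₁ ∈Δ p) = r-∨₀ φ₀ φ₁ (Δ⊆Γ ∈Δ) (weakenPremise α⪯ d≤ Δ⊆Γ p)
  weaken α⪯ d≤ Δ⊆Γ (r-∨₁ φ₀ φ₁ ∈Δ p) = r-∨₁ φ₀ φ₁ (Δ⊆Γ ∈Δ) (weakenPremise α⪯ d≤ Δ⊆Γ p)
  weaken α⪯ d≤ Δ⊆Γ (r-∀ φ ∈Δ ps) = r-∀ φ (Δ⊆Γ ∈Δ) (λ t → weakenPremise α⪯ d≤ Δ⊆Γ (ps t))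
  weaken α⪯ d≤ Δ⊆Γ (r-∃ φ ∈Δ t p) = r-∃ φ (Δ⊆Γ ∈Δ) t (weakenPremise α⪯ d≤ Δ⊆Γ p)
  weaken α⪯ d≤ Δ⊆Γ (r-X t ∈Δ ps) = r-X t (Δ⊆Γ ∈Δ) (λ s s◁t → weakenPremise α⪯ d≤ Δ⊆Γ (ps s s◁t))
  weaken α⪯ d≤ Δ⊆Γ (r-cut φ rk<d p q) =
    r-cut φ (<-≤-trans rk<d d≤) (weakenPremise α⪯ d≤ Δ⊆Γ p) (weakenPremise α⪯ d≤ Δ⊆Γ q)

  invert : ∀ {α d Δ Γ ψ χ} → Component ψ χ → Δ ⊆ ψ ∷ Γ → ⊢[ α , d ] Δ → ⊢[ α , d ] (χ ∷ Γ)
  invertPremise : ∀ {α d Δ Γ ψ χ θ} → Component ψ χ → Δ ⊆ ψ ∷ Γ →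
                  Premise α d Δ θ → Premise α d (χ ∷ Γ) θ
  invertPrincipal : ∀ {α d Δ Γ ψ χ} → Component ψ χ → Δ ⊆ ψ ∷ Γ →
                    Premise α d Δ χ → ⊢[ α , d ] (χ ∷ Γ)

  invertPremise c Δ⊆ (prem β β≺α e e≤d Λ Λ⊆ pf) =
    prem β β≺α e e≤d _ (∷-under ⊆-refl) (invert c (⊆-trans Λ⊆ (∷-under Δ⊆)) pf)

  invertPrincipal c Δ⊆ (prem β β≺α e e≤d Λ Λ⊆ pf) =
    weaken (inj₁ β≺α) e≤d ∷-contract (invert c (⊆-trans Λ⊆ (∷-under Δ⊆)) pf)

  invert c Δ⊆ (ax-lit φ φ∈ true) with Δ⊆ φ∈
  ... | here refl = ⊥-elim (Component⇒¬TrueLit c true)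
  ... | there φ∈Γ = ax-lit φ (there φ∈Γ) true
  invert c Δ⊆ (ax-X s t Xs∈ ¬Xt∈ s≡t) with Δ⊆ Xs∈ | Δ⊆ ¬Xt∈
  invert () Δ⊆ (ax-X s t Xs∈ ¬Xt∈ s≡t) | here refl | _
  invert () Δ⊆ (ax-X s t Xs∈ ¬Xt∈ s≡t) | there _ | here refl
  ... | there Xs∈Γ | there ¬Xt∈Γ = ax-X s t (there Xs∈Γ) (there ¬Xt∈Γ) s≡t
  invert c Δ⊆ (r-∧ φ₀ φ₁ ∈Δ p q) with Δ⊆ ∈Δ
  invert ∧-left  Δ⊆ (r-∧ φ₀ φ₁ ∈Δ p q) | here refl = invertPrincipal ∧-left Δ⊆ p
  invert ∧-right Δ⊆ (r-∧ φ₀ φ₁ ∈Δ p q) | here refl = invertPrincipal ∧-right Δ⊆ q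
  ... | there ∈Γ = r-∧ φ₀ φ₁ (there ∈Γ) (invertPremise c Δ⊆ p) (invertPremise c Δ⊆ q)
  invert c Δ⊆ (r-∨₀ φ₀ φ₁ ∈Δ p) with Δ⊆ ∈Δ
  invert () Δ⊆ (r-∨₀ φ₀ φ₁ ∈Δ p) | here refl
  ... | there ∈Γ = r-∨₀ φ₀ φ₁ (there ∈Γ) (invertPremise c Δ⊆ p)
  invert c Δ⊆ (r-∨₁ φ₀ φ₁ ∈Δ p) with Δ⊆ ∈Δ
  invert () Δ⊆ (r-∨₁ φ₀ φ₁ ∈Δ p) | here refl
  ... | there ∈Γ = r-∨₁ φ₀ φ₁ (there ∈Γ) (invertPremise c Δ⊆ p)
  invert c Δ⊆ (r-∀ φ ∈Δ ps) with Δ⊆ ∈Δ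
  invert (∀-inst t) Δ⊆ (r-∀ φ ∈Δ ps) | here refl = invertPrincipal (∀-inst t) Δ⊆ (ps t)
  ... | there ∈Γ = r-∀ φ (there ∈Γ) (λ t → invertPremise c Δ⊆ (ps t))
  invert c Δ⊆ (r-∃ φ ∈Δ t p) with Δ⊆ ∈Δ
  invert () Δ⊆ (r-∃ φ ∈Δ t p) | here refl
  ... | there ∈Γ = r-∃ φ (there ∈Γ) t (invertPremise c Δ⊆ p)
  invert c Δ⊆ (r-X t ∈Δ ps) with Δ⊆ ∈Δ
  invert () Δ⊆ (r-X t ∈Δ ps) | here refl
  ... | there ∈Γ = r-X t (there ∈Γ) (λ s s◁t → invertPremise c Δ⊆ (ps s s◁t))
  invert c Δ⊆ (r-cut φ rk<d p q) = r-cut φ rk<d (invertPremise c Δ⊆ p) (invertPremise c Δ⊆ q)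

  contractX : ∀ {α d Δ Γ s t} → `X s ∈ Γ → val s ≡ val t → Δ ⊆ `X t ∷ Γ →
              ⊢[ α , d ] Δ → ⊢[ α , d ] Γ
  contractXPremise : ∀ {α d Δ Γ s t θ} → `X s ∈ Γ → val s ≡ val t → Δ ⊆ `X t ∷ Γ →
                     Premise α d Δ θ → Premise α d Γ θ

  contractXPremise Xs∈ s≡t Δ⊆ (prem β β≺α e e≤d Λ Λ⊆ pf) =
    prem β β≺α e e≤d _ ⊆-refl (contractX (there Xs∈) s≡t (⊆-trans Λ⊆ (∷-under Δ⊆)) pf)

  contractX Xs∈ s≡t Δ⊆ (ax-lit φ φ∈ true) with Δ⊆ φ∈
  contractX Xs∈ s≡t Δ⊆ (ax-lit φ φ∈ ()) | here refl
  ... | there φ∈Γ = ax-lit φ φ∈Γ true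
  contractX Xs∈ s≡t Δ⊆ (ax-X u v Xu∈ ¬Xv∈ u≡v) with Δ⊆ Xu∈ | Δ⊆ ¬Xv∈
  ... | _          | here ()
  ... | here refl  | there ¬Xv∈Γ = ax-X _ v Xs∈ ¬Xv∈Γ (trans s≡t u≡v)
  ... | there Xu∈Γ | there ¬Xv∈Γ = ax-X u v Xu∈Γ ¬Xv∈Γ u≡v
  contractX Xs∈ s≡t Δ⊆ (r-∧ φ₀ φ₁ ∈Δ p q) with Δ⊆ ∈Δ
  ... | here ()
  ... | there ∈Γ = r-∧ φ₀ φ₁ ∈Γ (contractXPremise Xs∈ s≡t Δ⊆ p) (contractXPremise Xs∈ s≡t Δ⊆ q)
  contractX Xs∈ s≡t Δ⊆ (r-∨₀ φ₀ φ₁ ∈Δ p) with Δ⊆ ∈Δ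
  ... | here ()
  ... | there ∈Γ = r-∨₀ φ₀ φ₁ ∈Γ (contractXPremise Xs∈ s≡t Δ⊆ p)
  contractX Xs∈ s≡t Δ⊆ (r-∨₁ φ₀ φ₁ ∈Δ p) with Δ⊆ ∈Δ
  ... | here ()
  ... | there ∈Γ = r-∨₁ φ₀ φ₁ ∈Γ (contractXPremise Xs∈ s≡t Δ⊆ p)
  contractX Xs∈ s≡t Δ⊆ (r-∀ φ ∈Δ ps) with Δ⊆ ∈Δ
  ... | here ()
  ... | there ∈Γ = r-∀ φ ∈Γ (λ u → contractXPremise Xs∈ s≡t Δ⊆ (ps u))
  contractX Xs∈ s≡t Δ⊆ (r-∃ φ ∈Δ u p) with Δ⊆ ∈Δ
  ... | here ()
  ... | there ∈Γ = r-∃ φ ∈Γ u (contractXPremise Xs∈ s≡t Δ⊆ p)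
  contractX {s = s} Xs∈ s≡t Δ⊆ (r-X u ∈Δ ps) with Δ⊆ ∈Δ
  ... | here refl =
    r-X s Xs∈ (λ v v◁s → contractXPremise Xs∈ s≡t Δ⊆ (ps v (≡-subst (Rel◁ lhd (val v)) s≡t v◁s)))
  ... | there ∈Γ = r-X u ∈Γ (λ v v◁u → contractXPremise Xs∈ s≡t Δ⊆ (ps v v◁u))
  contractX Xs∈ s≡t Δ⊆ (r-cut φ rk<d p q) =
    r-cut φ rk<d (contractXPremise Xs∈ s≡t Δ⊆ p) (contractXPremise Xs∈ s≡t Δ⊆ q)

  reduce : ∀ {φ Γ α β d d′ Δ} → Reducible φ → rk φ ≤ d → ⊢[ α , d ] (neg φ ∷ Γ) →
           d′ ≤ d → Δ ⊆ φ ∷ Γ → ⊢[ β , d′ ] Δ → ⊢[ α ⊕ β , d ] Γ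
  reducePremise : ∀ {φ Γ α β d d′ Δ θ} → Reducible φ → rk φ ≤ d → ⊢[ α , d ] (neg φ ∷ Γ) →
                  d′ ≤ d → Δ ⊆ φ ∷ Γ → Premise β d′ Δ θ → Premise (α ⊕ β) d Γ θ
  reducePrincipal : ∀ {φ χ Γ α β d d′ Δ} → Reducible φ → rk φ ≤ d → ⊢[ α , d ] (neg φ ∷ Γ) →
                    d′ ≤ d → Δ ⊆ φ ∷ Γ → Component (neg φ) (neg χ) → rk χ < rk φ →
                    Premise β d′ Δ χ → ⊢[ α ⊕ β , d ] Γ

  reducePremise {α = α} {β} φ-red rk≤d ⊢¬φ d′≤d Δ⊆ (prem β′ β′≺β e e≤d′ Λ Λ⊆ pf) =
    prem (α ⊕ β′) (⊕-mono α β′ β β′≺β) _ ≤-refl _ ⊆-refl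
      (reduce φ-red rk≤d (weaken (inj₂ refl) ≤-refl (∷⁺ʳ _ (xs⊆x∷xs _ _)) ⊢¬φ)
              (≤-trans e≤d′ d′≤d) (⊆-trans Λ⊆ (∷-under Δ⊆)) pf)

  reducePrincipal {χ = χ} {α = α} φ-red rk≤d ⊢¬φ d′≤d Δ⊆ c rkχ<rkφ p =
    r-cut χ (<-≤-trans rkχ<rkφ rk≤d)
      (reducePremise φ-red rk≤d ⊢¬φ d′≤d Δ⊆ p)
      (prem α (α≺α⊕β α (Premise.α′≺α p)) _ ≤-refl _ ⊆-refl (invert c ⊆-refl ⊢¬φ))

  reduce φ-red rk≤d ⊢¬φ d′≤d Δ⊆ (ax-lit ψ ψ∈ true) with Δ⊆ ψ∈
  ... | here refl = ⊥-elim (Reducible⇒¬TrueLit φ-red true)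
  ... | there ψ∈Γ = ax-lit ψ ψ∈Γ true
  reduce φ-red rk≤d ⊢¬φ d′≤d Δ⊆ (ax-X s t Xs∈ ¬Xt∈ s≡t) with Δ⊆ Xs∈ | Δ⊆ ¬Xt∈
  ... | here refl  | _           = ⊥-elim (¬Reducible-X φ-red)
  ... | there Xs∈Γ | here refl   = weaken (α⪯α⊕β _ _) ≤-refl ⊆-refl (contractX Xs∈Γ s≡t ⊆-refl ⊢¬φ)
  ... | there Xs∈Γ | there ¬Xt∈Γ = ax-X s t Xs∈Γ ¬Xt∈Γ s≡t
  reduce φ-red rk≤d ⊢¬φ d′≤d Δ⊆ (r-∧ φ₀ φ₁ ∈Δ p q) with Δ⊆ ∈Δ
  ... | here refl = ⊥-elim (¬Reducible-∧ φ-red)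
  ... | there ∈Γ  = r-∧ φ₀ φ₁ ∈Γ (reducePremise φ-red rk≤d ⊢¬φ d′≤d Δ⊆ p)
                                 (reducePremise φ-red rk≤d ⊢¬φ d′≤d Δ⊆ q)
  reduce φ-red rk≤d ⊢¬φ d′≤d Δ⊆ (r-∨₀ φ₀ φ₁ ∈Δ p) with Δ⊆ ∈Δ
  ... | here refl = reducePrincipal φ-red rk≤d ⊢¬φ d′≤d Δ⊆ ∧-left (s≤s (m≤m⊔n _ _)) p
  ... | there ∈Γ  = r-∨₀ φ₀ φ₁ ∈Γ (reducePremise φ-red rk≤d ⊢¬φ d′≤d Δ⊆ p)
  reduce φ-red rk≤d ⊢¬φ d′≤d Δ⊆ (r-∨₁ φ₀ φ₁ ∈Δ p) with Δ⊆ ∈Δ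
  ... | here refl = reducePrincipal φ-red rk≤d ⊢¬φ d′≤d Δ⊆ ∧-right (s≤s (m≤n⊔m _ _)) p
  ... | there ∈Γ  = r-∨₁ φ₀ φ₁ ∈Γ (reducePremise φ-red rk≤d ⊢¬φ d′≤d Δ⊆ p)
  reduce φ-red rk≤d ⊢¬φ d′≤d Δ⊆ (r-∀ ψ ∈Δ ps) with Δ⊆ ∈Δ
  ... | here refl = ⊥-elim (¬Reducible-∀ φ-red)
  ... | there ∈Γ  = r-∀ ψ ∈Γ (λ t → reducePremise φ-red rk≤d ⊢¬φ d′≤d Δ⊆ (ps t))
  reduce φ-red rk≤d ⊢¬φ d′≤d Δ⊆ (r-∃ ψ ∈Δ t p) with Δ⊆ ∈Δ
  ... | here refl = reducePrincipal φ-red rk≤d ⊢¬φ d′≤d Δ⊆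
                      (≡-subst (Component _) (sym (neg-subst (λ _ → t) ψ)) (∀-inst t))
                      (rk-[]<rk-∃ ψ t) p
  ... | there ∈Γ  = r-∃ ψ ∈Γ t (reducePremise φ-red rk≤d ⊢¬φ d′≤d Δ⊆ p)
  reduce φ-red rk≤d ⊢¬φ d′≤d Δ⊆ (r-X t ∈Δ ps) with Δ⊆ ∈Δ
  ... | here refl = ⊥-elim (¬Reducible-X φ-red)
  ... | there ∈Γ  = r-X t ∈Γ (λ s s◁t → reducePremise φ-red rk≤d ⊢¬φ d′≤d Δ⊆ (ps s s◁t))
  reduce φ-red rk≤d ⊢¬φ d′≤d Δ⊆ (r-cut ψ rk<d′ p q) =
    r-cut ψ (<-≤-trans rk<d′ d′≤d) (reducePremise φ-red rk≤d ⊢¬φ d′≤d Δ⊆ p)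
                                    (reducePremise φ-red rk≤d ⊢¬φ d′≤d Δ⊆ q)

proposition4p6 : (E : OrdinalStructure) (lhd : Fm 2) → DefinesWellOrder lhd →
    let open OrdinalStructure E
        open Calculus E lhd
    in (φ : Sentence) (Γ : Sequent) (α β : Carrier) (d : ℕ) →
       (Disjunctive φ ⊎ Σ ClosedTerm (λ t → φ ≡ `¬X t)) → rk φ ≤ d →
       ⊢[ α , d ] (neg φ ∷ Γ) → ⊢[ β , d ] (φ ∷ Γ) → ⊢[ α ⊕ β , d ] Γ
proposition4p6 E lhd _ φ Γ α β d φ-red rk≤d ⊢¬φ ⊢φ =
  reduce E lhd φ-red rk≤d ⊢¬φ ≤-refl ⊆-refl ⊢φ
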